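{- Let $r,t$ be integers with $t\geq 1$ and $t+1\le r\le 4t-1$. Let $G$ be a multi $r$-edge-colored complete graph in which every edge has at least $t$ different colors, and suppose there is an edge $xy$ with $t<|\mathrm{col}(xy)|<r$. Then $V(G)$ can be covered by at most $r-t$ monochromatic components.
   Context: A complete graph $G$ is multi $r$-edge-colored if to each pair of distinct vertices $u,v$ a set $\emptyset\neq \mathrm{col}(uv)\subseteq [r]=\{1,\dots,r\}$ of colors is assigned, and the coloring is transitive: if $i\in \mathrm{col}(uv)\cap\mathrm{col}(vw)$ for distinct $u,v,w$, then $i\in\mathrm{col}(uw)$. The edge $uv$ has color $i$ if $i\in\mathrm{col}(uv)$. A monochromatic component of color $i$ is (the vertex set of) a connected component of the spanning subgraph of $G$ formed by the edges having color $i$. -}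

module Defs where

open import Data.Nat using (ℕ; _≤_; _<_)
open import Data.Fin using (Fin)
open import Data.Fin.Subset using (Subset; _∈_; ∣_∣; Nonempty)
open import Data.Product using (Σ; _×_; _,_; ∃)
open import Data.List using (List; length)
open import Data.List.Membership.Propositional renaming (_∈_ to _∈ₗ_)
open import Relation.Binary.PropositionalEquality using (_≡_; _≢_)
open import Relation.Binary.Construct.Closure.ReflexiveTransitive using (Star)

record MultiColoring (n r : ℕ) : Set where
  field
    col        : Fin n → Fin n → Subset r
    symmetric  : ∀ u v → u ≢ v → col u v ≡ col v u
    nonempty   : ∀ u v → u ≢ v → Nonempty (col u v)
    transitive : ∀ (u v w : Fin n) (i : Fin r) → u ≢ v → v ≢ w → u ≢ w →
                 i ∈ col u v → i ∈ col v w → i ∈ col u w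

open MultiColoring public

HasColor : ∀ {n r} → MultiColoring n r → Fin r → Fin n → Fin n → Set
HasColor c i u v = (u ≢ v) × (i ∈ col c u v)

InComponent : ∀ {n r} → MultiColoring n r → Fin r → Fin n → Fin n → Set
InComponent c i v w = Star (HasColor c i) v w

-- A monochromatic component is given by (color, representative vertex).
-- The vertex set is covered by the list of components cs.
Covers : ∀ {n r} → MultiColoring n r → List (Fin r × Fin n) → Set
Covers {n} {r} c cs = ∀ (w : Fin n) →
  Σ (Fin r × Fin n) λ { (i , v) → ((i , v) ∈ₗ cs) × InComponent c i v w }

CoverableBy : ∀ {n r} → MultiColoring n r → ℕ → Set
CoverableBy c k = Σ _ λ cs → (length cs ≤ k) × Covers c cs

-- Let S be the colour set of the edge xy and s = |S|, so t < s < r. We cover by monochromatic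
-- components through x or y. In a triangle x y w the edges xw and yw share only colours of S,
-- and yw has a colour of S only if xw has it too. Hence a vertex w missed by the chosen
-- components, whose edges xw and yw carry at least 2t colours together, forces a count
-- contradiction:
--   if s + t ≤ r, take at x all colours of S and k = ⌊(r - s - t)/2⌋ further colours K, at y
--   the colours K; then xw and yw are disjoint and avoid S ∪ K, so 2t ≤ r - s - k, which
--   r ≤ 4t - 1 rules out;
--   if s + t > r, take at x only r - t colours A ⊆ S; then xw ∪ yw avoids A and
--   xw ∩ yw ⊆ S ∖ A, so 2t ≤ t + (s - (r - t)), i.e. r ≤ s.
module Submission where

open import Defs
open import Data.Nat using (ℕ; _≤_; _<_; _+_; _*_; _∸_)
open import Data.Fin using (Fin)
open import Data.Fin.Subset using (∣_∣)
open import Data.Product using (Σ; _×_)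
open import Relation.Binary.PropositionalEquality using (_≢_)

open import Data.Empty using (⊥; ⊥-elim)
open import Data.Fin using (zero; suc; _≟_)
open import Data.Fin.Subset
  using (Subset; inside; outside; _∈_; _⊆_; _∩_; _∪_; ∁; ⊤; Nonempty; Empty)
  renaming (⊥ to ∅)
open import Data.Fin.Subset.Properties
  using (Empty-unique; nonempty?; ∣⊥∣≡0; ∣⊤∣≡n; ∣∁p∣≡n∸∣p∣; p⊆q⇒∣p∣≤∣q∣; out⊆; in⊆in; ⊥⊆; ⊆⊤;
         p∩q⊆p; x∈p∩q⁺; x∈p∩q⁻; x∈p∪q⁺; x∈p∪q⁻; x∈∁p⇒x∉p)
open import Data.List using (List; []; _∷_; length; map; _++_)
open import Data.List.Properties using (length-map; length-++)
open import Data.List.Membership.Propositional using () renaming (_∈_ to _∈ₗ_)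
open import Data.List.Membership.Propositional.Properties using (∈-map⁺; ∈-++⁺ˡ; ∈-++⁺ʳ)
import Data.List.Relation.Unary.Any as Any
open import Data.Nat using (zero; suc; z≤n; s≤s; _≤?_; ⌊_/2⌋; ⌈_/2⌉)
open import Data.Nat.Properties
  using (+-assoc; +-comm; +-suc; +-identityʳ; +-mono-≤; +-monoˡ-≤; +-monoʳ-≤; +-monoʳ-<;
         +-cancelʳ-≤; ≤-reflexive; ≤-trans; ≤-<-trans; <⇒≤; <⇒≱; ≰⇒>; >⇒≢; m≤m+n;
         ∸-monoˡ-≤; ∸-monoʳ-≤; m+[n∸m]≡n; m+n∸n≡m; m+n≤o⇒m≤o∸n; m<n⇒0<n∸m;
         ⌊n/2⌋≤n; ⌊n/2⌋≤⌈n/2⌉; ⌊n/2⌋+⌈n/2⌉≡n; ⌈n/2⌉-mono; n≡⌈n+n/2⌉;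
         +-commutativeSemigroup; module ≤-Reasoning)
open import Algebra.Properties.CommutativeSemigroup +-commutativeSemigroup
  using (interchange; xy∙z≈xz∙y)
open import Data.Product using (_,_; proj₂)
open import Data.Sum using ([_,_]; inj₁)
open import Data.Vec using ([]; _∷_; here; there)
open import Function using (_∘_)
open import Relation.Binary.Construct.Closure.ReflexiveTransitive using (ε; _◅_)
open import Relation.Binary.PropositionalEquality
  using (_≡_; refl; sym; trans; cong; cong₂; subst; module ≡-Reasoning)
open import Relation.Nullary using (yes; no; contradiction)

private
  variable
    n r : ℕ
    p q u : Subset n

∣p∪q∣+∣p∩q∣≡∣p∣+∣q∣ : ∀ (p q : Subset n) → ∣ p ∪ q ∣ + ∣ p ∩ q ∣ ≡ ∣ p ∣ + ∣ q ∣
∣p∪q∣+∣p∩q∣≡∣p∣+∣q∣ []            []            = refl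
∣p∪q∣+∣p∩q∣≡∣p∣+∣q∣ (inside  ∷ p) (inside  ∷ q) = cong suc (trans (+-suc _ _)
  (trans (cong suc (∣p∪q∣+∣p∩q∣≡∣p∣+∣q∣ p q)) (sym (+-suc _ _))))
∣p∪q∣+∣p∩q∣≡∣p∣+∣q∣ (inside  ∷ p) (outside ∷ q) = cong suc (∣p∪q∣+∣p∩q∣≡∣p∣+∣q∣ p q)
∣p∪q∣+∣p∩q∣≡∣p∣+∣q∣ (outside ∷ p) (inside  ∷ q) =
  trans (cong suc (∣p∪q∣+∣p∩q∣≡∣p∣+∣q∣ p q)) (sym (+-suc _ _))
∣p∪q∣+∣p∩q∣≡∣p∣+∣q∣ (outside ∷ p) (outside ∷ q) = ∣p∪q∣+∣p∩q∣≡∣p∣+∣q∣ p q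

Empty⇒∣p∣≡0 : Empty p → ∣ p ∣ ≡ 0
Empty⇒∣p∣≡0 {n} empty = trans (cong ∣_∣ (Empty-unique empty)) (∣⊥∣≡0 n)

0<∣p∣⇒Nonempty : 0 < ∣ p ∣ → Nonempty p
0<∣p∣⇒Nonempty {p = p} 0<∣p∣ with nonempty? p
... | yes nonempty = nonempty
... | no  empty    = contradiction (Empty⇒∣p∣≡0 empty) (>⇒≢ 0<∣p∣)

Empty-∩⁺ : (∀ {i} → i ∈ p → i ∈ q → ⊥) → Empty (p ∩ q)
Empty-∩⁺ {p = p} {q} disjoint (i , i∈p∩q) = let i∈p , i∈q = x∈p∩q⁻ p q i∈p∩q in disjoint i∈p i∈q

Empty-∩⁻ : Empty (p ∩ q) → ∀ {i} → i ∈ p → i ∈ q → ⊥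
Empty-∩⁻ empty i∈p i∈q = empty (_ , x∈p∩q⁺ (i∈p , i∈q))

disjoint⇒∣p∪q∣≡∣p∣+∣q∣ : Empty (p ∩ q) → ∣ p ∪ q ∣ ≡ ∣ p ∣ + ∣ q ∣
disjoint⇒∣p∪q∣≡∣p∣+∣q∣ {p = p} {q} disjoint = begin
  ∣ p ∪ q ∣              ≡⟨ +-identityʳ _ ⟨
  ∣ p ∪ q ∣ + 0          ≡⟨ cong (∣ p ∪ q ∣ +_) (Empty⇒∣p∣≡0 disjoint) ⟨
  ∣ p ∪ q ∣ + ∣ p ∩ q ∣  ≡⟨ ∣p∪q∣+∣p∩q∣≡∣p∣+∣q∣ p q ⟩
  ∣ p ∣ + ∣ q ∣          ∎
  where open ≡-Reasoning

∪-lub : p ⊆ u → q ⊆ u → p ∪ q ⊆ u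
∪-lub {p = p} {q = q} p⊆u q⊆u = [ p⊆u , q⊆u ] ∘ x∈p∪q⁻ p q

disjoint⇒∣p∣+∣q∣≤∣u∣ : Empty (p ∩ q) → p ⊆ u → q ⊆ u → ∣ p ∣ + ∣ q ∣ ≤ ∣ u ∣
disjoint⇒∣p∣+∣q∣≤∣u∣ disjoint p⊆u q⊆u =
  subst (_≤ _) (disjoint⇒∣p∪q∣≡∣p∣+∣q∣ disjoint) (p⊆q⇒∣p∣≤∣q∣ (∪-lub p⊆u q⊆u))

⊆-of-size : ∀ (p : Subset n) {k} → k ≤ ∣ p ∣ → Σ (Subset n) λ q → q ⊆ p × ∣ q ∣ ≡ k
⊆-of-size []            z≤n = [] , (λ ()) , refl
⊆-of-size (outside ∷ p) k≤∣p∣ with ⊆-of-size p k≤∣p∣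
... | q , q⊆p , ∣q∣≡k = outside ∷ q , out⊆ q⊆p , ∣q∣≡k
⊆-of-size {suc n} (inside ∷ p) {zero} _ = ∅ , ⊥⊆ , ∣⊥∣≡0 (suc n)
⊆-of-size (inside ∷ p) {suc k} (s≤s k≤∣p∣) with ⊆-of-size p k≤∣p∣
... | q , q⊆p , ∣q∣≡k = inside ∷ q , in⊆in q⊆p , cong suc ∣q∣≡k

elements : Subset n → List (Fin n)
elements []            = []
elements (inside  ∷ p) = zero ∷ map suc (elements p)
elements (outside ∷ p) = map suc (elements p)

length-elements : ∀ (p : Subset n) → length (elements p) ≡ ∣ p ∣
length-elements []            = refl
length-elements (inside  ∷ p) = cong suc (trans (length-map suc (elements p)) (length-elements p))
length-elements (outside ∷ p) = trans (length-map suc (elements p)) (length-elements p)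

∈-elements : ∀ {i : Fin n} → i ∈ p → i ∈ₗ elements p
∈-elements {p = inside  ∷ p} here        = Any.here refl
∈-elements {p = inside  ∷ p} (there i∈p) = Any.there (∈-map⁺ suc (∈-elements i∈p))
∈-elements {p = outside ∷ p} (there i∈p) = ∈-map⁺ suc (∈-elements i∈p)

module _ (c : MultiColoring n r) where

  private
    variable
      v w x y : Fin n

  col-sym : v ≢ w → col c v w ⊆ col c w v
  col-sym {v} {w} v≢w = subst (_ ∈_) (symmetric c v w v≢w)

  col-trans : x ≢ v → v ≢ w → x ≢ w → col c x v ∩ col c v w ⊆ col c x w
  col-trans x≢v v≢w x≢w i∈∩ = let i∈xv , i∈vw = x∈p∩q⁻ _ _ i∈∩ in
    transitive c _ _ _ _ x≢v v≢w x≢w i∈xv i∈vw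

  common-col-⊆ : x ≢ y → x ≢ w → y ≢ w → col c x w ∩ col c y w ⊆ col c x y
  common-col-⊆ x≢y x≢w y≢w i∈∩ = let i∈xw , i∈yw = x∈p∩q⁻ _ _ i∈∩ in
    col-trans x≢w (y≢w ∘ sym) x≢y (x∈p∩q⁺ (i∈xw , col-sym y≢w i∈yw))

  Misses : Fin n → Subset r → Fin n → Set
  Misses v K w = Empty (col c v w ∩ K)

  componentsAt : Subset r → Fin n → List (Fin r × Fin n)
  componentsAt K v = map (_, v) (elements K)

  length-componentsAt : ∀ K → length (componentsAt K v) ≡ ∣ K ∣
  length-componentsAt K = trans (length-map _ (elements K)) (length-elements K)

  ∈-componentsAt : ∀ {K i} → i ∈ K → (i , v) ∈ₗ componentsAt K v
  ∈-componentsAt i∈K = ∈-map⁺ _ (∈-elements i∈K)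

  covers-componentsAt : x ≢ y → ∀ K₁ K₂ → Nonempty (col c x y ∩ K₁) →
    (∀ w → x ≢ w → y ≢ w → Misses x K₁ w → Misses y K₂ w → ⊥) →
    Covers c (componentsAt K₁ x ++ componentsAt K₂ y)
  covers-componentsAt {x} {y} x≢y K₁ K₂ (i , i∈xy∩K₁) missed w with x ≟ w
  ... | yes refl = (i , x) , ∈-++⁺ˡ (∈-componentsAt (proj₂ (x∈p∩q⁻ _ _ i∈xy∩K₁))) , ε
  ... | no x≢w with nonempty? (col c x w ∩ K₁)
  ...   | yes (j , j∈xw∩K₁) = let j∈xw , j∈K₁ = x∈p∩q⁻ _ _ j∈xw∩K₁ in
    (j , x) , ∈-++⁺ˡ (∈-componentsAt j∈K₁) , (x≢w , j∈xw) ◅ ε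
  ...   | no x-misses with y ≟ w
  ...     | yes refl = contradiction (i , i∈xy∩K₁) x-misses
  ...     | no y≢w with nonempty? (col c y w ∩ K₂)
  ...       | yes (j , j∈yw∩K₂) = let j∈yw , j∈K₂ = x∈p∩q⁻ _ _ j∈yw∩K₂ in
    (j , y) , ∈-++⁺ʳ _ (∈-componentsAt j∈K₂) , (y≢w , j∈yw) ◅ ε
  ...       | no y-misses = ⊥-elim (missed w x≢w y≢w x-misses y-misses)

  coverableBy-componentsAt : x ≢ y → ∀ K₁ K₂ → Nonempty (col c x y ∩ K₁) →
    (∀ w → x ≢ w → y ≢ w → Misses x K₁ w → Misses y K₂ w → ⊥) →
    CoverableBy c (∣ K₁ ∣ + ∣ K₂ ∣)
  coverableBy-componentsAt {x} {y} x≢y K₁ K₂ nonempty missed =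
    componentsAt K₁ x ++ componentsAt K₂ y , ≤-reflexive length≡ ,
    covers-componentsAt x≢y K₁ K₂ nonempty missed
    where
    length≡ : length (componentsAt K₁ x ++ componentsAt K₂ y) ≡ ∣ K₁ ∣ + ∣ K₂ ∣
    length≡ = trans (length-++ (componentsAt K₁ x))
      (cong₂ _+_ (length-componentsAt K₁) (length-componentsAt K₂))

  coverableBy-mono : ∀ {k m} → k ≤ m → CoverableBy c k → CoverableBy c m
  coverableBy-mono k≤m (cs , length≤k , covers) = cs , ≤-trans length≤k k≤m , covers

  module _ {t} (t≤∣col∣ : ∀ u v → u ≢ v → t ≤ ∣ col c u v ∣) where

    t+t≤∣col∣+∣col∣ : x ≢ w → y ≢ w → t + t ≤ ∣ col c x w ∣ + ∣ col c y w ∣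
    t+t≤∣col∣+∣col∣ {x} {w} {y} x≢w y≢w = +-mono-≤ (t≤∣col∣ x w x≢w) (t≤∣col∣ y w y≢w)

    coverableBy-extending-col : x ≢ y → Nonempty (col c x y) → ∀ {k} → k ≤ ∣ ∁ (col c x y) ∣ →
      r < t + t + (∣ col c x y ∣ + k) → CoverableBy c (∣ col c x y ∣ + k + k)
    coverableBy-extending-col {x} {y} x≢y (i , i∈S) k≤∣∁S∣ r<
      with ⊆-of-size (∁ (col c x y)) k≤∣∁S∣
    ... | K , K⊆∁S , refl = subst (CoverableBy c) (cong (_+ ∣ K ∣) ∣S∪K∣≡)
      (coverableBy-componentsAt x≢y (S ∪ K) K (i , x∈p∩q⁺ (i∈S , x∈p∪q⁺ (inj₁ i∈S))) missed)
      where
      S = col c x y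
      ∣S∪K∣≡ : ∣ S ∪ K ∣ ≡ ∣ S ∣ + ∣ K ∣
      ∣S∪K∣≡ = disjoint⇒∣p∪q∣≡∣p∣+∣q∣ (Empty-∩⁺ λ j∈S j∈K → x∈∁p⇒x∉p (K⊆∁S j∈K) j∈S)
      missed : ∀ w → x ≢ w → y ≢ w → Misses x (S ∪ K) w → Misses y K w → ⊥
      missed w x≢w y≢w x-misses y-misses = <⇒≱ r< (begin
        t + t + (∣ S ∣ + ∣ K ∣)          ≤⟨ +-monoˡ-≤ _ (t+t≤∣col∣+∣col∣ x≢w y≢w) ⟩
        ∣ X ∣ + ∣ Y ∣ + (∣ S ∣ + ∣ K ∣)  ≡⟨ cong₂ _+_ (disjoint⇒∣p∪q∣≡∣p∣+∣q∣ X∩Y-empty) ∣S∪K∣≡ ⟨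
        ∣ X ∪ Y ∣ + ∣ S ∪ K ∣            ≤⟨ disjoint⇒∣p∣+∣q∣≤∣u∣ XY∩SK-empty ⊆⊤ ⊆⊤ ⟩
        ∣ ⊤ {r} ∣                        ≡⟨ ∣⊤∣≡n r ⟩
        r                                ∎)
        where
        open ≤-Reasoning
        X = col c x w
        Y = col c y w
        X∉S∪K : ∀ {j} → j ∈ X → j ∈ S ∪ K → ⊥
        X∉S∪K = Empty-∩⁻ x-misses
        Y∉S : ∀ {j} → j ∈ Y → j ∈ S → ⊥
        Y∉S j∈Y j∈S = X∉S∪K (col-trans x≢y y≢w x≢w (x∈p∩q⁺ (j∈S , j∈Y))) (x∈p∪q⁺ (inj₁ j∈S))
        X∩Y-empty : Empty (X ∩ Y)
        X∩Y-empty = Empty-∩⁺ λ j∈X j∈Y → Y∉S j∈Y (common-col-⊆ x≢y x≢w y≢w (x∈p∩q⁺ (j∈X , j∈Y)))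
        XY∩SK-empty : Empty ((X ∪ Y) ∩ (S ∪ K))
        XY∩SK-empty = Empty-∩⁺ λ j∈X∪Y j∈S∪K →
          [ (λ j∈X → X∉S∪K j∈X j∈S∪K)
          , (λ j∈Y → [ Y∉S j∈Y , Empty-∩⁻ y-misses j∈Y ] (x∈p∪q⁻ S K j∈S∪K))
          ] (x∈p∪q⁻ X Y j∈X∪Y)

    coverableBy-restricting-col : x ≢ y → ∀ {a} → 0 < a → a ≤ ∣ col c x y ∣ →
      r + ∣ col c x y ∣ < (t + a) + (t + a) → CoverableBy c a
    coverableBy-restricting-col {x} {y} x≢y 0<a a≤∣S∣ r+∣S∣<
      with ⊆-of-size (col c x y) a≤∣S∣
    ... | A , A⊆S , refl with 0<∣p∣⇒Nonempty 0<a
    ...   | i , i∈A = coverableBy-mono (≤-reflexive ∣A∣+0≡∣A∣)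
      (coverableBy-componentsAt x≢y A ∅ (i , x∈p∩q⁺ (A⊆S i∈A , i∈A)) missed)
      where
      S = col c x y
      a = ∣ A ∣
      ∣A∣+0≡∣A∣ : a + ∣ ∅ {r} ∣ ≡ a
      ∣A∣+0≡∣A∣ = trans (cong (a +_) (∣⊥∣≡0 r)) (+-identityʳ a)
      missed : ∀ w → x ≢ w → y ≢ w → Misses x A w → Misses y ∅ w → ⊥
      missed w x≢w y≢w x-misses _ = <⇒≱ r+∣S∣< (begin
        (t + a) + (t + a)                  ≡⟨ interchange t a t a ⟩
        (t + t) + (a + a)                  ≤⟨ +-monoˡ-≤ _ (t+t≤∣col∣+∣col∣ x≢w y≢w) ⟩
        (∣ X ∣ + ∣ Y ∣) + (a + a)          ≡⟨ cong (_+ (a + a)) (∣p∪q∣+∣p∩q∣≡∣p∣+∣q∣ X Y) ⟨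
        (∣ X ∪ Y ∣ + ∣ X ∩ Y ∣) + (a + a)  ≡⟨ interchange ∣ X ∪ Y ∣ ∣ X ∩ Y ∣ a a ⟩
        (∣ X ∪ Y ∣ + a) + (∣ X ∩ Y ∣ + a)  ≤⟨ +-mono-≤ X∪Y-bound X∩Y-bound ⟩
        r + ∣ S ∣                          ∎)
        where
        open ≤-Reasoning
        X = col c x w
        Y = col c y w
        X∉A : ∀ {j} → j ∈ X → j ∈ A → ⊥
        X∉A = Empty-∩⁻ x-misses
        Y∉A : ∀ {j} → j ∈ Y → j ∈ A → ⊥
        Y∉A j∈Y j∈A = X∉A (col-trans x≢y y≢w x≢w (x∈p∩q⁺ (A⊆S j∈A , j∈Y))) j∈A
        X∪Y-bound : ∣ X ∪ Y ∣ + a ≤ r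
        X∪Y-bound = subst (∣ X ∪ Y ∣ + a ≤_) (∣⊤∣≡n r) (disjoint⇒∣p∣+∣q∣≤∣u∣
          (Empty-∩⁺ λ j∈X∪Y j∈A → [ (λ j∈X → X∉A j∈X j∈A) , (λ j∈Y → Y∉A j∈Y j∈A) ]
                                    (x∈p∪q⁻ X Y j∈X∪Y))
          ⊆⊤ ⊆⊤)
        X∩Y-bound : ∣ X ∩ Y ∣ + a ≤ ∣ S ∣
        X∩Y-bound = disjoint⇒∣p∣+∣q∣≤∣u∣ (Empty-∩⁺ (X∉A ∘ p∩q⊆p X Y))
          (common-col-⊆ x≢y x≢w y≢w) A⊆S

few-colours-length : ∀ {r s t} → s + t ≤ r →
  s + ⌊ (r ∸ (s + t)) /2⌋ + ⌊ (r ∸ (s + t)) /2⌋ ≤ r ∸ t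
few-colours-length {r} {s} {t} s+t≤r = m+n≤o⇒m≤o∸n _ (begin
  s + k + k + t          ≡⟨ cong (_+ t) (+-assoc s k k) ⟩
  s + (k + k) + t        ≡⟨ xy∙z≈xz∙y s (k + k) t ⟩
  s + t + (k + k)        ≤⟨ +-monoʳ-≤ (s + t) (+-monoʳ-≤ k (⌊n/2⌋≤⌈n/2⌉ d)) ⟩
  s + t + (k + ⌈ d /2⌉)  ≡⟨ cong (s + t +_) (⌊n/2⌋+⌈n/2⌉≡n d) ⟩
  s + t + d              ≡⟨ m+[n∸m]≡n s+t≤r ⟩
  r                      ∎)
  where
  open ≤-Reasoning
  d = r ∸ (s + t)
  k = ⌊ d /2⌋

-- Since s > t and r ≤ 4t - 1, the leftover d = r - s - t is at most 2t - 2, so ⌈d/2⌉ < t.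
few-colours-excess : ∀ {r s t} → 1 ≤ t → t < s → s + t ≤ r → r ≤ 4 * t ∸ 1 →
  r < t + t + (s + ⌊ (r ∸ (s + t)) /2⌋)
few-colours-excess {r} {s} {t@(suc _)} _ t<s s+t≤r r≤4t∸1 = begin-strict
  r                            ≡⟨ m+[n∸m]≡n s+t≤r ⟨
  s + t + d                    ≡⟨ cong (s + t +_) (⌊n/2⌋+⌈n/2⌉≡n d) ⟨
  s + t + (⌊ d /2⌋ + ⌈ d /2⌉)  <⟨ +-monoʳ-< (s + t) (+-monoʳ-< ⌊ d /2⌋ ⌈d/2⌉<t) ⟩
  s + t + (⌊ d /2⌋ + t)        ≡⟨ interchange s t ⌊ d /2⌋ t ⟩
  s + ⌊ d /2⌋ + (t + t)        ≡⟨ +-comm (s + ⌊ d /2⌋) (t + t) ⟩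
  t + t + (s + ⌊ d /2⌋)        ∎
  where
  open ≤-Reasoning
  d = r ∸ (s + t)
  2+d≤t+t : 2 + d ≤ t + t
  2+d≤t+t = +-cancelʳ-≤ (t + t) _ _ (begin
    2 + d + (t + t)          ≡⟨ cong (2 +_) (+-comm d (t + t)) ⟩
    suc (suc t + t + d)      ≤⟨ s≤s (+-monoˡ-≤ d (+-monoˡ-≤ t t<s)) ⟩
    suc (s + t + d)          ≡⟨ cong suc (m+[n∸m]≡n s+t≤r) ⟩
    suc r                    ≤⟨ s≤s r≤4t∸1 ⟩
    t + (t + (t + (t + 0)))  ≡⟨ cong (λ m → t + (t + (t + m))) (+-identityʳ t) ⟩
    t + (t + (t + t))        ≡⟨ +-assoc t t (t + t) ⟨
    t + t + (t + t)          ∎)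
  ⌈d/2⌉<t : ⌈ d /2⌉ < t
  ⌈d/2⌉<t = subst (suc ⌈ d /2⌉ ≤_) (sym (n≡⌈n+n/2⌉ t)) (⌈n/2⌉-mono 2+d≤t+t)

mainTheorem4 : (n r t : ℕ) → 1 ≤ t → t + 1 ≤ r → r ≤ 4 * t ∸ 1 →
    (c : MultiColoring n r) →
    (∀ (u v : Fin n) → u ≢ v → t ≤ ∣ col c u v ∣) →
    (Σ (Fin n) λ x → Σ (Fin n) λ y → (x ≢ y) × (t < ∣ col c x y ∣) × (∣ col c x y ∣ < r)) →
    CoverableBy c (r ∸ t)
mainTheorem4 n r t 1≤t t+1≤r r≤4t∸1 c t≤∣col∣ (x , y , x≢y , t<s , s<r)
  with ∣ col c x y ∣ + t ≤? r
... | yes s+t≤r = coverableBy-mono c (few-colours-length {s = s} s+t≤r)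
  (coverableBy-extending-col c t≤∣col∣ x≢y (0<∣p∣⇒Nonempty (≤-<-trans z≤n t<s))
    ⌊d/2⌋≤∣∁S∣ (few-colours-excess 1≤t t<s s+t≤r r≤4t∸1))
  where
  s = ∣ col c x y ∣
  ⌊d/2⌋≤∣∁S∣ : ⌊ (r ∸ (s + t)) /2⌋ ≤ ∣ ∁ (col c x y) ∣
  ⌊d/2⌋≤∣∁S∣ = ≤-trans (⌊n/2⌋≤n _)
    (≤-trans (∸-monoʳ-≤ r (m≤m+n s t)) (≤-reflexive (sym (∣∁p∣≡n∸∣p∣ (col c x y)))))
... | no s+t≰r = coverableBy-restricting-col c t≤∣col∣ x≢y (m<n⇒0<n∸m t<r) r∸t≤s
  (subst (λ m → r + ∣ col c x y ∣ < m + m) (sym (m+[n∸m]≡n (<⇒≤ t<r))) (+-monoʳ-< r s<r))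
  where
  t<r : t < r
  t<r = subst (_≤ r) (+-comm t 1) t+1≤r
  r∸t≤s : r ∸ t ≤ ∣ col c x y ∣
  r∸t≤s = subst (r ∸ t ≤_) (m+n∸n≡m _ t) (∸-monoˡ-≤ t (<⇒≤ (≰⇒> s+t≰r)))
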